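{- Let $D$ be an $m$-colored digraph such that for every vertex $x\in V(D)$ there exists a monochromatic $xw$-walk of some color $c$, for some vertex $w$ such that every arc incident with $w$ has color $c$. Then $D$ has a kernel by monochromatic paths.
   Context: An $m$-colored digraph is a finite loopless digraph whose arcs are colored with $m$ colors. A walk (path) is monochromatic if all its arcs have the same color. A kernel by monochromatic paths is a set $S\subseteq V(D)$ such that no two different vertices of $S$ are joined by a monochromatic path, and every vertex not in $S$ has a monochromatic path to some vertex of $S$. -}

module Defs where

open import Data.Nat using (ℕ)
open import Data.Fin using (Fin)
open import Data.List using (List; []; _∷_)
open import Data.List.Membership.Propositional using (_∈_)
open import Data.List.Relation.Unary.All using (All)
open import Data.List.Relation.Unary.Unique.Propositional using (Unique)
open import Data.Product using (_×_; Σ; ∃; ∃-syntax)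
open import Data.Sum using (_⊎_)
open import Relation.Binary.PropositionalEquality using (_≡_; _≢_)
open import Relation.Nullary using (¬_)

record Arc (n m : ℕ) : Set where
  constructor arc
  field
    tail  : Fin n
    head  : Fin n
    color : Fin m
open Arc public

-- An m-coloured digraph on vertex set Fin n: a finite list of coloured arcs,
-- without loops.  (Parallel arcs are permitted, e.g. of different colours.)
record ColoredDigraph (n m : ℕ) : Set where
  field
    arcs     : List (Arc n m)
    loopless : All (λ a → tail a ≢ head a) arcs
open ColoredDigraph public

module _ {n m : ℕ} (D : ColoredDigraph n m) where

  data MonoWalk (c : Fin m) : Fin n → Fin n → List (Fin n) → Set where
    nil  : ∀ x → MonoWalk c x x (x ∷ [])
    cons : ∀ {x y z vs} → arc x y c ∈ arcs D → MonoWalk c y z vs →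
           MonoWalk c x z (x ∷ vs)

  MonoPath : Fin n → Fin n → Set
  MonoPath x y = ∃[ c ] ∃[ vs ] (MonoWalk c x y vs × Unique vs)

  IsKernelByMonoPaths : (Fin n → Set) → Set
  IsKernelByMonoPaths S =
    (∀ u v → S u → S v → u ≢ v → ¬ MonoPath u v) ×
    (∀ x → ¬ S x → ∃[ y ] (S y × MonoPath x y))

  HasKernelByMonoPaths : Set₁
  HasKernelByMonoPaths = ∃[ S ] IsKernelByMonoPaths S

  AllIncidentArcsColored : Fin n → Fin m → Set
  AllIncidentArcsColored w c =
    ∀ a → a ∈ arcs D → (tail a ≡ w ⊎ head a ≡ w) → color a ≡ c

-- Call w monochromatic when all arcs incident with w have one color c.  A
-- monochromatic walk into w and one out of w then both have color c, so they
-- concatenate: reachability by monochromatic walks is transitive through every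
-- monochromatic vertex, hence a preorder on the monochromatic vertices.  Its
-- terminal strong components, one vertex chosen from each, form a kernel by
-- monochromatic paths: they are pairwise unreachable, and every vertex x
-- reaches some monochromatic w by hypothesis, hence through w a terminal
-- component above w.
module Submission where

open import Defs
open import Level using (Level)
open import Data.Nat using (ℕ; zero; suc; z≤n; s≤s) renaming (_≤_ to _≤ℕ_)
open import Data.Fin using (Fin; zero; suc; _<_; _≟_)
open import Data.Fin.Properties using (any?; _<?_; <-cmp; <-irrefl; <-trans; injective⇒≤)
open import Data.Fin.Induction using (spo-noetherian)
open import Data.List using (List; length; lookup)
open import Data.List.Membership.Propositional using (_∈_; find; lose)
open import Data.List.Membership.Propositional.Properties using (∈-lookup)
open import Data.List.Relation.Unary.All as All using ([]; _∷_)
open import Data.List.Relation.Unary.All.Properties using (¬Any⇒All¬)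
open import Data.List.Relation.Unary.Any as Any using (Any; here; there)
open import Data.List.Relation.Unary.AllPairs using ([]; _∷_)
open import Data.List.Relation.Unary.Unique.Propositional using (Unique)
open import Data.Product using (_×_; ∃-syntax; _,_; proj₂)
open import Data.Sum using (_⊎_; inj₁; inj₂)
open import Function using (flip)
open import Function.Definitions using (Injective)
open import Induction.WellFounded using (WellFounded; Acc; acc)
open import Relation.Binary using (Rel; Decidable; Reflexive; IsStrictPartialOrder; tri<; tri≈; tri>)
open import Relation.Binary.PropositionalEquality using (_≡_; _≢_; refl; sym; cong; isEquivalence; resp₂)
open import Relation.Nullary using (¬_; Dec; yes; no; contradiction)
open import Relation.Nullary.Decidable using (map′; _⊎-dec_; _×-dec_; _→-dec_)
open import Relation.Unary using (Pred)

private
  variable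
    a p r : Level
    k : ℕ

lookup-injective : {xs : List (Fin k)} → Unique xs → Injective _≡_ _≡_ (lookup xs)
lookup-injective (x∉xs ∷ _) {zero}  {zero}  _  = refl
lookup-injective (x∉xs ∷ _) {zero}  {suc j} eq = contradiction eq (All.lookup x∉xs (∈-lookup j))
lookup-injective (x∉xs ∷ _) {suc i} {zero}  eq = contradiction (sym eq) (All.lookup x∉xs (∈-lookup i))
lookup-injective (_ ∷ xs!) {suc i} {suc j} eq = cong suc (lookup-injective xs! eq)

unique⇒length≤ : {xs : List (Fin k)} → Unique xs → length xs ≤ℕ k
unique⇒length≤ xs! = injective⇒≤ (lookup-injective xs!)

∃-maximal : {_⊏_ : Rel (Fin k) r} → WellFounded (flip _⊏_) → Decidable _⊏_ →
            {P : Pred (Fin k) p} → (∀ x → Dec (P x)) → ∀ {x} → P x →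
            ∃[ y ] (P y × ∀ z → P z → ¬ y ⊏ z)
∃-maximal {_⊏_ = _⊏_} wf _⊏?_ {P} P? {x} = go (wf x)
  where
  go : ∀ {x} → Acc (flip _⊏_) x → P x → ∃[ y ] (P y × ∀ z → P z → ¬ y ⊏ z)
  go {x} (acc above) Px with any? (λ z → P? z ×-dec x ⊏? z)
  ... | yes (z , Pz , x⊏z) = go (above x⊏z) Pz
  ... | no none             = x , Px , λ z Pz x⊏z → none (z , Pz , x⊏z)

module TerminalComponents {W : Pred (Fin k) a} (W? : ∀ x → Dec (W x))
  {_↝_ : Rel (Fin k) r} (_↝?_ : Decidable _↝_) (↝-refl : Reflexive _↝_)
  (↝-trans-at : ∀ {x y z} → W y → x ↝ y → y ↝ z → x ↝ z) where

  -- z lies strictly above y in the reachability preorder on W, where within a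
  -- strong component the smaller index counts as higher.
  _≺_ : Rel (Fin k) _
  y ≺ z = W y × W z × y ↝ z × (z ↝ y → z < y)

  ≺-isStrictPartialOrder : IsStrictPartialOrder _≡_ _≺_
  ≺-isStrictPartialOrder = record
    { isEquivalence = isEquivalence
    ; irrefl        = λ { refl (_ , _ , _ , y<y) → <-irrefl refl (y<y ↝-refl) }
    ; trans         = ≺-trans
    ; <-resp-≈      = resp₂ _≺_
    }
    where
    ≺-trans : ∀ {x y z} → x ≺ y → y ≺ z → x ≺ z
    ≺-trans (Wx , Wy , x↝y , y<x) (_ , Wz , y↝z , z<y) =
      Wx , Wz , ↝-trans-at Wy x↝y y↝z ,
      λ z↝x → <-trans (z<y (↝-trans-at Wx z↝x x↝y)) (y<x (↝-trans-at Wz y↝z z↝x))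

  _≺?_ : Decidable _≺_
  y ≺? z = W? y ×-dec W? z ×-dec y ↝? z ×-dec (z ↝? y →-dec z <? y)

  Terminal : Pred (Fin k) _
  Terminal s = W s × ∀ z → ¬ s ≺ z

  terminal-above : ∀ {w} → W w → ∃[ s ] (Terminal s × w ↝ s)
  terminal-above {w} Ww
    with ∃-maximal (spo-noetherian ≺-isStrictPartialOrder) _≺?_ (λ z → W? z ×-dec w ↝? z) (Ww , ↝-refl)
  ... | s , (Ws , w↝s) , maximal =
    s , (Ws , λ z s≺z@(_ , Wz , s↝z , _) → maximal z (Wz , ↝-trans-at Ws w↝s s↝z) s≺z) , w↝s

  terminal-independent : ∀ {s t} → Terminal s → Terminal t → s ≢ t → ¬ s ↝ t
  terminal-independent {s} {t} (Ws , s-top) (Wt , t-top) s≢t s↝t with t ↝? s | <-cmp s t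
  ... | no t↝̸s | _            = s-top t (Ws , Wt , s↝t , λ t↝s → contradiction t↝s t↝̸s)
  ... | yes t↝s | tri< s<t _ _ = t-top s (Wt , Ws , t↝s , λ _ → s<t)
  ... | yes _   | tri≈ _ s≡t _ = s≢t s≡t
  ... | yes _   | tri> _ _ t<s = s-top t (Ws , Wt , s↝t , λ _ → t<s)

module _ {n m : ℕ} (D : ColoredDigraph n m) where

  private
    variable
      c : Fin m
      x y z : Fin n
      vs ws : List (Fin n)

  ++-monoWalk : MonoWalk D c x y vs → MonoWalk D c y z ws → ∃[ us ] MonoWalk D c x z us
  ++-monoWalk (nil _)    q = _ , q
  ++-monoWalk (cons e p) q = _ , cons e (proj₂ (++-monoWalk p q))

  monoPath-from : MonoWalk D c y z ws → Unique ws → x ∈ ws →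
                  ∃[ us ] (MonoWalk D c x z us × Unique us)
  monoPath-from p@(nil _)    ws!       (here refl)  = _ , p , ws!
  monoPath-from p@(cons _ _) ws!       (here refl)  = _ , p , ws!
  monoPath-from (cons _ p)   (_ ∷ ws!) (there x∈ws) = monoPath-from p ws! x∈ws

  monoWalk⇒monoPath : MonoWalk D c x y vs → ∃[ us ] (MonoWalk D c x y us × Unique us)
  monoWalk⇒monoPath (nil x) = _ , nil x , [] ∷ []
  monoWalk⇒monoPath {x = x} (cons e p) with monoWalk⇒monoPath p
  ... | ws , q , ws! with Any.any? (x ≟_) ws
  ... | yes x∈ws = monoPath-from q ws! x∈ws
  ... | no  x∉ws = _ , cons e q , ¬Any⇒All¬ ws x∉ws ∷ ws!

  -- The x ≡ y case is not redundant: a nil walk needs a color, and there is none if m = 0.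
  _↝_ : Rel (Fin n) _
  x ↝ y = x ≡ y ⊎ ∃[ c ] ∃[ vs ] MonoWalk D c x y vs

  ↝-refl : Reflexive _↝_
  ↝-refl = inj₁ refl

  ReachWithin : Fin m → ℕ → Rel (Fin n) _
  ReachWithin c zero    x y = x ≡ y
  ReachWithin c (suc k) x y =
    x ≡ y ⊎ Any (λ e → tail e ≡ x × color e ≡ c × ReachWithin c k (head e) y) (arcs D)

  reachWithin? : ∀ c k → Decidable (ReachWithin c k)
  reachWithin? c zero    x y = x ≟ y
  reachWithin? c (suc k) x y =
    x ≟ y ⊎-dec Any.any? (λ e → tail e ≟ x ×-dec color e ≟ c ×-dec reachWithin? c k (head e) y) (arcs D)

  reachWithin⇒monoWalk : ∀ k → ReachWithin c k x y → ∃[ vs ] MonoWalk D c x y vs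
  reachWithin⇒monoWalk zero    refl        = _ , nil _
  reachWithin⇒monoWalk (suc k) (inj₁ refl) = _ , nil _
  reachWithin⇒monoWalk (suc k) (inj₂ step) with find step
  ... | arc _ _ _ , e , refl , refl , rest = _ , cons e (proj₂ (reachWithin⇒monoWalk k rest))

  monoWalk⇒reachWithin : MonoWalk D c x y vs → ReachWithin c (length vs) x y
  monoWalk⇒reachWithin (nil _)    = inj₁ refl
  monoWalk⇒reachWithin (cons e p) = inj₂ (lose e (refl , refl , monoWalk⇒reachWithin p))

  reachWithin-mono : ∀ {k l} → k ≤ℕ l → ReachWithin c k x y → ReachWithin c l x y
  reachWithin-mono {l = zero}  z≤n       x≡y         = x≡y
  reachWithin-mono {l = suc l} z≤n       x≡y         = inj₁ x≡y
  reachWithin-mono             (s≤s _)   (inj₁ x≡y)  = inj₁ x≡y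
  reachWithin-mono             (s≤s k≤l) (inj₂ step) =
    inj₂ (Any.map (λ (t , col , rest) → t , col , reachWithin-mono k≤l rest) step)

  -- A walk shortens to a path, which visits at most n vertices.
  _↝?_ : Decidable _↝_
  x ↝? y = map′ from to (x ≟ y ⊎-dec any? (λ c → reachWithin? c n x y))
    where
    from : x ≡ y ⊎ ∃[ c ] ReachWithin c n x y → x ↝ y
    from (inj₁ x≡y)     = inj₁ x≡y
    from (inj₂ (c , r)) = inj₂ (c , reachWithin⇒monoWalk n r)
    to : x ↝ y → x ≡ y ⊎ ∃[ c ] ReachWithin c n x y
    to (inj₁ x≡y)         = inj₁ x≡y
    to (inj₂ (c , _ , p)) with monoWalk⇒monoPath p
    ... | _ , q , us! = inj₂ (c , reachWithin-mono (unique⇒length≤ us!) (monoWalk⇒reachWithin q))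

  Monochromatic : Pred (Fin n) _
  Monochromatic w = ∃[ c ] AllIncidentArcsColored D w c

  monochromatic? : ∀ w → Dec (Monochromatic w)
  monochromatic? w = any? λ c →
    map′ (λ incident e e∈ → All.lookup incident e∈) (λ colored → All.tabulate λ {e} → colored e)
         (All.all? (λ e → (tail e ≟ w ⊎-dec head e ≟ w) →-dec color e ≟ c) (arcs D))

  monoWalk-into-color : ∀ {c′} → AllIncidentArcsColored D y c′ →
                        MonoWalk D c x y vs → x ≡ y ⊎ c ≡ c′
  monoWalk-into-color incident (nil _) = inj₁ refl
  monoWalk-into-color incident (cons e p) with monoWalk-into-color incident p
  ... | inj₁ refl = inj₂ (incident _ e (inj₂ refl))
  ... | inj₂ c≡c′ = inj₂ c≡c′

  ↝-trans-monochromatic : Monochromatic y → x ↝ y → y ↝ z → x ↝ z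
  ↝-trans-monochromatic _ (inj₁ refl) y↝z = y↝z
  ↝-trans-monochromatic _ x↝y (inj₁ refl) = x↝y
  ↝-trans-monochromatic _ x↝y (inj₂ (_ , _ , nil _)) = x↝y
  ↝-trans-monochromatic (_ , incident) (inj₂ (c , _ , p)) (inj₂ (_ , _ , q@(cons e _)))
    with monoWalk-into-color incident p | incident _ e (inj₁ refl)
  ... | inj₁ refl | _    = inj₂ (_ , _ , q)
  ... | inj₂ refl | refl = inj₂ (c , ++-monoWalk p q)

corollary1 : (n m : ℕ) (D : ColoredDigraph n m) →
    (∀ x → ∃[ c ] ∃[ w ] ∃[ vs ] (MonoWalk D c x w vs × AllIncidentArcsColored D w c)) →
    HasKernelByMonoPaths D
corollary1 n m D reaches-monochromatic = Terminal , independent , absorbing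
  where
  open TerminalComponents (monochromatic? D) (_↝?_ D) (↝-refl D) (↝-trans-monochromatic D)

  independent : ∀ u v → Terminal u → Terminal v → u ≢ v → ¬ MonoPath D u v
  independent _ _ Tu Tv u≢v (c , vs , p , _) = terminal-independent Tu Tv u≢v (inj₂ (c , vs , p))

  absorbing : ∀ x → ¬ Terminal x → ∃[ y ] (Terminal y × MonoPath D x y)
  absorbing x ¬Tx with reaches-monochromatic x
  ... | c , w , vs , p , incident with terminal-above (c , incident)
  ... | y , Ty , w↝y with ↝-trans-monochromatic D (c , incident) (inj₂ (c , vs , p)) w↝y
  ...   | inj₁ refl            = contradiction Ty ¬Tx
  ...   | inj₂ (c′ , _ , x⇝y) = y , Ty , c′ , monoWalk⇒monoPath D x⇝y
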